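{- For $j\in\mathbb Z_{\ge0}$ let $f_j(x,y)=\frac{(j!)^2}{(x)_j(y)_j}$ (a rational function of $x,y$), and set $f_{ -1}(x,y)=0$. Then for every $j\ge 0$, as rational functions in $x,y$, $$(x-1)(x-2)\bigl(f_j(x-2,y)-f_{j-1}(x-2,y)\bigr)+(x-1)(2x-5)f_{j-1}(x-1,y)-(x-1)(x-y-1)f_j(x-1,y)-(x-2)^2f_{j-1}(x,y)$$ equals $(x-1)(y-1)$ if $j=0$ and $0$ if $j>0$.
   Context: $(x)_j=x(x+1)\cdots(x+j-1)$ is the Pochhammer symbol, with $(x)_0=1$. -}

module Defs where

open import Data.Nat using (ℕ; zero; suc; _∸_; _!)
open import Data.Integer using (+_)
open import Data.Rational using (ℚ; 0ℚ; 1ℚ; _+_; _-_; _*_; _/_; _÷_; ≢-nonZero)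
open import Data.Rational.Properties using (_≟_)
open import Relation.Nullary using (yes; no)

⟦_⟧ : ℕ → ℚ
⟦ n ⟧ = + n / 1

poch : ℚ → ℕ → ℚ
poch x zero    = 1ℚ
poch x (suc j) = poch x j * (x + ⟦ j ⟧)

-- total division (p / 0 := 0); only ever used at points where the
-- denominator is assumed nonzero in the statement
div : ℚ → ℚ → ℚ
div p q with q ≟ 0ℚ
... | yes _ = 0ℚ
... | no q≢0 = _÷_ p q {{≢-nonZero q≢0}}

f : ℕ → ℚ → ℚ → ℚ
f j x y = div (⟦ j ! ⟧ * ⟦ j ! ⟧) (poch x j * poch y j)

fPrev : ℕ → ℚ → ℚ → ℚ
fPrev zero    x y = 0ℚ
fPrev (suc j) x y = f j x y

LHS : ℕ → ℚ → ℚ → ℚ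
LHS j x y =
    (x - ⟦ 1 ⟧) * (x - ⟦ 2 ⟧) * (f j (x - ⟦ 2 ⟧) y - fPrev j (x - ⟦ 2 ⟧) y)
  + (x - ⟦ 1 ⟧) * (⟦ 2 ⟧ * x - ⟦ 5 ⟧) * fPrev j (x - ⟦ 1 ⟧) y
  - (x - ⟦ 1 ⟧) * (x - y - ⟦ 1 ⟧) * f j (x - ⟦ 1 ⟧) y
  - (x - ⟦ 2 ⟧) * (x - ⟦ 2 ⟧) * fPrev j x y

RHS : ℕ → ℚ → ℚ → ℚ
RHS zero    x y = (x - ⟦ 1 ⟧) * (y - ⟦ 1 ⟧)
RHS (suc j) x y = 0ℚ

-- Two contiguity relations of f follow by cancelling Pochhammer factors:
--   f_{k+1}(z,y) (z+k)(y+k) = (k+1)² f_k(z,y)   and   z f_k(z,y) = (z+k) f_k(z+1,y).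
-- For j = k+1 they make every value in the identity a rational multiple of f_k(x-1,y), and the
-- resulting coefficient of f_k(x-1,y) vanishes identically. To stay division-free, the left-hand
-- side times (x-2)(x-1+k)(x-2+k)(y+k) is written as an explicit polynomial combination of the four
-- instances of these relations. For j = 0 the identity is a polynomial one.
{-# OPTIONS --safe #-}
module Submission where

open import Defs
open import Data.Nat using (ℕ; _∸_)
open import Data.Rational using (ℚ; 0ℚ; _-_)
open import Relation.Binary.PropositionalEquality using (_≡_; _≢_)

open import Data.Nat as ℕ using (suc; _!)
import Data.Integer as ℤ
import Data.Integer.Properties as ℤ
import Data.Nat.Coprimality as Coprimality
open import Data.Rational using (mkℚ; 1ℚ; _+_; _*_; -_; _/_; 1/_; ≢-nonZero)
open import Data.Rational.Properties
  using ( _≟_; normalize-coprime; +-assoc; *-assoc; *-identityʳ; *-zeroˡ; *-zeroʳ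
        ; *-inverseˡ; *-inverseʳ; *-1-commutativeMonoid; +-*-commutativeRing
        ; heytingCommutativeRing)
open import Algebra.Bundles using (CommutativeMonoid)
open import Algebra.Properties.CommutativeSemigroup
  (CommutativeMonoid.commutativeSemigroup *-1-commutativeMonoid) using (xy∙z≈xz∙y)
open import Algebra.Apartness.Properties.HeytingCommutativeRing heytingCommutativeRing
  using (x#0y#0→xy#0)
open import Data.Empty using (⊥-elim)
open import Level using (0ℓ)
open import Relation.Binary.PropositionalEquality
  using (refl; sym; trans; cong; cong₂; subst; module ≡-Reasoning)
open import Relation.Nullary.Decidable.Core using (yes; no; dec⇒maybe)
open import Tactic.RingSolver using (solve-∀)
open import Tactic.RingSolver.Core.AlmostCommutativeRing
  using (AlmostCommutativeRing; fromCommutativeRing)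

open ≡-Reasoning

ℚ-ring : AlmostCommutativeRing 0ℓ 0ℓ
ℚ-ring = fromCommutativeRing +-*-commutativeRing (λ p → dec⇒maybe (0ℚ ≟ p))

⟦⟧≡mkℚ : ∀ n → ⟦ n ⟧ ≡ mkℚ (ℤ.+ n) 0 (Coprimality.sym (Coprimality.1-coprimeTo n))
⟦⟧≡mkℚ n = normalize-coprime _

⟦⟧-suc : ∀ n → ⟦ suc n ⟧ ≡ 1ℚ + ⟦ n ⟧
⟦⟧-suc n = trans (cong (λ i → (ℤ.+ 1 ℤ.+ i) / 1) (sym (ℤ.*-identityʳ (ℤ.+ n))))
                  (sym (cong (1ℚ +_) (⟦⟧≡mkℚ n)))

⟦⟧-* : ∀ m n → ⟦ m ℕ.* n ⟧ ≡ ⟦ m ⟧ * ⟦ n ⟧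
⟦⟧-* m n = trans (cong (_/ 1) (ℤ.pos-* m n)) (sym (cong₂ _*_ (⟦⟧≡mkℚ m) (⟦⟧≡mkℚ n)))

⟦!⟧-suc : ∀ k → ⟦ suc k ! ⟧ ≡ (1ℚ + ⟦ k ⟧) * ⟦ k ! ⟧
⟦!⟧-suc k = trans (⟦⟧-* (suc k) (k !)) (cong (_* ⟦ k ! ⟧) (⟦⟧-suc k))

*-cancelʳ-≡ : ∀ {p q r} → r ≢ 0ℚ → p * r ≡ q * r → p ≡ q
*-cancelʳ-≡ {p} {q} {r} r≢0 pr≡qr = begin
  p            ≡⟨ undo p ⟨
  p * r * 1/ r ≡⟨ cong (_* 1/ r) pr≡qr ⟩
  q * r * 1/ r ≡⟨ undo q ⟩
  q            ∎
  where
  instance _ = ≢-nonZero r≢0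
  undo : ∀ s → s * r * 1/ r ≡ s
  undo s = trans (*-assoc s r (1/ r)) (trans (cong (s *_) (*-inverseʳ r)) (*-identityʳ s))

p*q≢0⇒p≢0 : ∀ {p q} → p * q ≢ 0ℚ → p ≢ 0ℚ
p*q≢0⇒p≢0 {q = q} pq≢0 refl = pq≢0 (*-zeroˡ q)

p*q≢0⇒q≢0 : ∀ {p q} → p * q ≢ 0ℚ → q ≢ 0ℚ
p*q≢0⇒q≢0 {p = p} pq≢0 refl = pq≢0 (*-zeroʳ p)

div[p,q]*q≡p : ∀ p {q} → q ≢ 0ℚ → div p q * q ≡ p
div[p,q]*q≡p p {q} q≢0 with q ≟ 0ℚ
... | yes q≡0 = ⊥-elim (q≢0 q≡0)
... | no  _   = trans (*-assoc p (1/ q) q) (trans (cong (p *_) (*-inverseˡ q)) (*-identityʳ p))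
  where instance _ = ≢-nonZero q≢0

poch-sucˡ : ∀ z k → poch z (suc k) ≡ z * poch (z + 1ℚ) k
poch-sucˡ z ℕ.zero    = unit z
  where
  unit : ∀ z → 1ℚ * (z + ⟦ 0 ⟧) ≡ z * 1ℚ
  unit = solve-∀ ℚ-ring
poch-sucˡ z (suc k) = begin
  poch z (suc k) * (z + ⟦ suc k ⟧)           ≡⟨ cong₂ _*_ (poch-sucˡ z k) (cong (z +_) (⟦⟧-suc k)) ⟩
  z * poch (z + 1ℚ) k * (z + (1ℚ + ⟦ k ⟧))   ≡⟨ *-assoc z _ _ ⟩
  z * (poch (z + 1ℚ) k * (z + (1ℚ + ⟦ k ⟧))) ≡⟨ cong (λ t → z * (poch (z + 1ℚ) k * t)) (+-assoc z 1ℚ ⟦ k ⟧) ⟨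
  z * poch (z + 1ℚ) (suc k)                  ∎

poch-suc≢0⇒poch≢0 : ∀ z k → poch z (suc k) ≢ 0ℚ → poch z k ≢ 0ℚ
poch-suc≢0⇒poch≢0 z k = p*q≢0⇒p≢0 {q = z + ⟦ k ⟧}

poch-suc≢0⇒z+k≢0 : ∀ z k → poch z (suc k) ≢ 0ℚ → z + ⟦ k ⟧ ≢ 0ℚ
poch-suc≢0⇒z+k≢0 z k = p*q≢0⇒q≢0 {p = poch z k}

poch-suc≢0⇒z≢0 : ∀ z k → poch z (suc k) ≢ 0ℚ → z ≢ 0ℚ
poch-suc≢0⇒z≢0 z k zₖ₊₁≢0 = p*q≢0⇒p≢0 (subst (_≢ 0ℚ) (poch-sucˡ z k) zₖ₊₁≢0)

f*denominator≡numerator : ∀ j z y → poch z j ≢ 0ℚ → poch y j ≢ 0ℚ →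
                          f j z y * (poch z j * poch y j) ≡ ⟦ j ! ⟧ * ⟦ j ! ⟧
f*denominator≡numerator j z y zⱼ≢0 yⱼ≢0 = div[p,q]*q≡p _ (x#0y#0→xy#0 zⱼ≢0 yⱼ≢0)

f-suc : ∀ k z y → poch z (suc k) ≢ 0ℚ → poch y (suc k) ≢ 0ℚ →
        f (suc k) z y * ((z + ⟦ k ⟧) * (y + ⟦ k ⟧)) ≡ f k z y * ((1ℚ + ⟦ k ⟧) * (1ℚ + ⟦ k ⟧))
f-suc k z y zₖ₊₁≢0 yₖ₊₁≢0 = *-cancelʳ-≡ (x#0y#0→xy#0 zₖ≢0 yₖ≢0) (begin
  f (suc k) z y * ((z + K) * (y + K)) * (poch z k * poch y k)
    ≡⟨ regroup (f (suc k) z y) (z + K) (y + K) (poch z k) (poch y k) ⟩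
  f (suc k) z y * (poch z (suc k) * poch y (suc k))
    ≡⟨ f*denominator≡numerator (suc k) z y zₖ₊₁≢0 yₖ₊₁≢0 ⟩
  ⟦ suc k ! ⟧ * ⟦ suc k ! ⟧
    ≡⟨ cong (λ t → t * t) (⟦!⟧-suc k) ⟩
  (1ℚ + K) * ⟦ k ! ⟧ * ((1ℚ + K) * ⟦ k ! ⟧)
    ≡⟨ [ab][ab]≡[bb][aa] (1ℚ + K) ⟦ k ! ⟧ ⟩
  ⟦ k ! ⟧ * ⟦ k ! ⟧ * ((1ℚ + K) * (1ℚ + K))
    ≡⟨ cong (_* ((1ℚ + K) * (1ℚ + K))) (f*denominator≡numerator k z y zₖ≢0 yₖ≢0) ⟨
  f k z y * (poch z k * poch y k) * ((1ℚ + K) * (1ℚ + K))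
    ≡⟨ xy∙z≈xz∙y (f k z y) (poch z k * poch y k) ((1ℚ + K) * (1ℚ + K)) ⟩
  f k z y * ((1ℚ + K) * (1ℚ + K)) * (poch z k * poch y k) ∎)
  where
  K = ⟦ k ⟧
  zₖ≢0 = poch-suc≢0⇒poch≢0 z k zₖ₊₁≢0
  yₖ≢0 = poch-suc≢0⇒poch≢0 y k yₖ₊₁≢0
  regroup : ∀ u a b p q → u * (a * b) * (p * q) ≡ u * (p * a * (q * b))
  regroup = solve-∀ ℚ-ring
  [ab][ab]≡[bb][aa] : ∀ a b → a * b * (a * b) ≡ b * b * (a * a)
  [ab][ab]≡[bb][aa] = solve-∀ ℚ-ring

f-shift : ∀ k y z {z′} → z + 1ℚ ≡ z′ → poch z k ≢ 0ℚ → poch z′ k ≢ 0ℚ → poch y k ≢ 0ℚ →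
          f k z y * z ≡ f k z′ y * (z + ⟦ k ⟧)
f-shift k y z refl zₖ≢0 z′ₖ≢0 yₖ≢0 = *-cancelʳ-≡ (x#0y#0→xy#0 z′ₖ≢0 yₖ≢0) (begin
  f k z y * z * (poch z′ k * poch y k)
    ≡⟨ regroup₁ (f k z y) z (poch z′ k) (poch y k) ⟩
  f k z y * (z * poch z′ k * poch y k)
    ≡⟨ cong (λ t → f k z y * (t * poch y k)) (poch-sucˡ z k) ⟨
  f k z y * (poch z k * (z + ⟦ k ⟧) * poch y k)
    ≡⟨ regroup₂ (f k z y) (poch z k) (z + ⟦ k ⟧) (poch y k) ⟩
  f k z y * (poch z k * poch y k) * (z + ⟦ k ⟧)
    ≡⟨ cong (_* (z + ⟦ k ⟧)) (trans (f*denominator≡numerator k z y zₖ≢0 yₖ≢0)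
                                    (sym (f*denominator≡numerator k z′ y z′ₖ≢0 yₖ≢0))) ⟩
  f k z′ y * (poch z′ k * poch y k) * (z + ⟦ k ⟧)
    ≡⟨ xy∙z≈xz∙y (f k z′ y) (poch z′ k * poch y k) (z + ⟦ k ⟧) ⟩
  f k z′ y * (z + ⟦ k ⟧) * (poch z′ k * poch y k) ∎)
  where
  z′ = z + 1ℚ
  regroup₁ : ∀ u a b c → u * a * (b * c) ≡ u * (a * b * c)
  regroup₁ = solve-∀ ℚ-ring
  regroup₂ : ∀ u a b c → u * (a * b * c) ≡ u * (a * c) * b
  regroup₂ = solve-∀ ℚ-ring

combination-of-differences≡0 : ∀ {l₁ r₁ l₂ r₂ l₃ r₃ l₄ r₄} c₁ c₂ c₃ c₄ →
  l₁ ≡ r₁ → l₂ ≡ r₂ → l₃ ≡ r₃ → l₄ ≡ r₄ →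
  c₁ * (l₁ - r₁) + c₂ * (l₂ - r₂) + c₃ * (l₃ - r₃) + c₄ * (l₄ - r₄) ≡ 0ℚ
combination-of-differences≡0 {l₁} {_} {l₂} {_} {l₃} {_} {l₄} c₁ c₂ c₃ c₄ refl refl refl refl =
  vanish c₁ c₂ c₃ c₄ l₁ l₂ l₃ l₄
  where
  vanish : ∀ c₁ c₂ c₃ c₄ l₁ l₂ l₃ l₄ →
           c₁ * (l₁ - l₁) + c₂ * (l₂ - l₂) + c₃ * (l₃ - l₃) + c₄ * (l₄ - l₄) ≡ 0ℚ
  vanish = solve-∀ ℚ-ring

-- uᵢ and vᵢ stand for f_{k+1}(x-i,y) and f_k(x-i,y). The cᵢ come from eliminating v₀, v₂, u₁, u₂
-- in favour of v₁; what remains is v₁ times a multiple of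
-- (1+K)² - (x-1+K)(x-2+K) + (2x-5)(x-1+K) - (x-2)², which is 0.
contiguity-combination≡0 : ∀ x y K u₂ u₁ v₂ v₁ v₀ →
  v₁ * (x - ⟦ 1 ⟧) ≡ v₀ * (x - ⟦ 1 ⟧ + K) →
  v₂ * (x - ⟦ 2 ⟧) ≡ v₁ * (x - ⟦ 2 ⟧ + K) →
  u₁ * ((x - ⟦ 1 ⟧ + K) * (y + K)) ≡ v₁ * ((1ℚ + K) * (1ℚ + K)) →
  u₂ * ((x - ⟦ 2 ⟧ + K) * (y + K)) ≡ v₂ * ((1ℚ + K) * (1ℚ + K)) →
  x - ⟦ 2 ⟧ ≢ 0ℚ → x - ⟦ 1 ⟧ + K ≢ 0ℚ → x - ⟦ 2 ⟧ + K ≢ 0ℚ → y + K ≢ 0ℚ →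
  (x - ⟦ 1 ⟧) * (x - ⟦ 2 ⟧) * (u₂ - v₂)
    + (x - ⟦ 1 ⟧) * (⟦ 2 ⟧ * x - ⟦ 5 ⟧) * v₁
    - (x - ⟦ 1 ⟧) * (x - y - ⟦ 1 ⟧) * u₁
    - (x - ⟦ 2 ⟧) * (x - ⟦ 2 ⟧) * v₀ ≡ 0ℚ
contiguity-combination≡0 x y K u₂ u₁ v₂ v₁ v₀ r₁ r₂ r₃ r₄ ≢0₁ ≢0₂ ≢0₃ ≢0₄ =
  *-cancelʳ-≡ D≢0 (trans (certificate x y K u₂ u₁ v₂ v₁ v₀)
                   (trans (combination-of-differences≡0 c₁ c₂ c₃ c₄ r₁ r₂ r₃ r₄) (sym (*-zeroˡ D))))
  where
  D = (x - ⟦ 2 ⟧) * ((x - ⟦ 1 ⟧ + K) * (x - ⟦ 2 ⟧ + K) * (y + K))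
  D≢0 : D ≢ 0ℚ
  D≢0 = x#0y#0→xy#0 ≢0₁ (x#0y#0→xy#0 (x#0y#0→xy#0 ≢0₂ ≢0₃) ≢0₄)
  c₁ = (x - ⟦ 2 ⟧) * (x - ⟦ 2 ⟧) * (x - ⟦ 2 ⟧) * (y + K) * (x - ⟦ 2 ⟧ + K)
  c₂ = (x - ⟦ 1 ⟧) * (x - ⟦ 2 ⟧) * (x - ⟦ 1 ⟧ + K) * ((1ℚ + K) * (1ℚ + K) - (y + K) * (x - ⟦ 2 ⟧ + K))
  c₃ = - ((x - ⟦ 1 ⟧) * (x - y - ⟦ 1 ⟧) * (x - ⟦ 2 ⟧ + K) * (x - ⟦ 2 ⟧))
  c₄ = (x - ⟦ 1 ⟧) * (x - ⟦ 2 ⟧) * (x - ⟦ 2 ⟧) * (x - ⟦ 1 ⟧ + K)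
  certificate : ∀ x y K u₂ u₁ v₂ v₁ v₀ →
    ( (x - ⟦ 1 ⟧) * (x - ⟦ 2 ⟧) * (u₂ - v₂)
    + (x - ⟦ 1 ⟧) * (⟦ 2 ⟧ * x - ⟦ 5 ⟧) * v₁
    - (x - ⟦ 1 ⟧) * (x - y - ⟦ 1 ⟧) * u₁
    - (x - ⟦ 2 ⟧) * (x - ⟦ 2 ⟧) * v₀)
    * ((x - ⟦ 2 ⟧) * ((x - ⟦ 1 ⟧ + K) * (x - ⟦ 2 ⟧ + K) * (y + K)))
    ≡ (x - ⟦ 2 ⟧) * (x - ⟦ 2 ⟧) * (x - ⟦ 2 ⟧) * (y + K) * (x - ⟦ 2 ⟧ + K)
        * (v₁ * (x - ⟦ 1 ⟧) - v₀ * (x - ⟦ 1 ⟧ + K))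
    + (x - ⟦ 1 ⟧) * (x - ⟦ 2 ⟧) * (x - ⟦ 1 ⟧ + K)
        * ((1ℚ + K) * (1ℚ + K) - (y + K) * (x - ⟦ 2 ⟧ + K))
        * (v₂ * (x - ⟦ 2 ⟧) - v₁ * (x - ⟦ 2 ⟧ + K))
    + - ((x - ⟦ 1 ⟧) * (x - y - ⟦ 1 ⟧) * (x - ⟦ 2 ⟧ + K) * (x - ⟦ 2 ⟧))
        * (u₁ * ((x - ⟦ 1 ⟧ + K) * (y + K)) - v₁ * ((1ℚ + K) * (1ℚ + K)))
    + (x - ⟦ 1 ⟧) * (x - ⟦ 2 ⟧) * (x - ⟦ 2 ⟧) * (x - ⟦ 1 ⟧ + K)
        * (u₂ * ((x - ⟦ 2 ⟧ + K) * (y + K)) - v₂ * ((1ℚ + K) * (1ℚ + K)))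
  certificate = solve-∀ ℚ-ring

-- f 0 z y computes to 1ℚ.
LHS₀≡RHS₀ : ∀ x y → LHS 0 x y ≡ RHS 0 x y
LHS₀≡RHS₀ = polynomial-identity
  where
  polynomial-identity : ∀ x y →
    (x - ⟦ 1 ⟧) * (x - ⟦ 2 ⟧) * (1ℚ - 0ℚ) + (x - ⟦ 1 ⟧) * (⟦ 2 ⟧ * x - ⟦ 5 ⟧) * 0ℚ
      - (x - ⟦ 1 ⟧) * (x - y - ⟦ 1 ⟧) * 1ℚ - (x - ⟦ 2 ⟧) * (x - ⟦ 2 ⟧) * 0ℚ
    ≡ (x - ⟦ 1 ⟧) * (y - ⟦ 1 ⟧)
  polynomial-identity = solve-∀ ℚ-ring

[x-1]+1≡x : ∀ x → x - ⟦ 1 ⟧ + 1ℚ ≡ x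
[x-1]+1≡x = solve-∀ ℚ-ring

[x-2]+1≡x-1 : ∀ x → x - ⟦ 2 ⟧ + 1ℚ ≡ x - ⟦ 1 ⟧
[x-2]+1≡x-1 = solve-∀ ℚ-ring

mainTheorem3 : (j : ℕ) (x y : ℚ)
    → poch (x - ⟦ 2 ⟧) j ≢ 0ℚ
    → poch (x - ⟦ 1 ⟧) j ≢ 0ℚ
    → poch x (j ∸ 1) ≢ 0ℚ
    → poch y j ≢ 0ℚ
    → LHS j x y ≡ RHS j x y
mainTheorem3 ℕ.zero  x y _ _ _ _ = LHS₀≡RHS₀ x y
mainTheorem3 (suc k) x y [x-2]ₖ₊₁≢0 [x-1]ₖ₊₁≢0 xₖ≢0 yₖ₊₁≢0 =
  contiguity-combination≡0 x y ⟦ k ⟧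
    (f (suc k) (x - ⟦ 2 ⟧) y) (f (suc k) (x - ⟦ 1 ⟧) y) (f k (x - ⟦ 2 ⟧) y) (f k (x - ⟦ 1 ⟧) y) (f k x y)
    (f-shift k y (x - ⟦ 1 ⟧) ([x-1]+1≡x x) [x-1]ₖ≢0 xₖ≢0 yₖ≢0)
    (f-shift k y (x - ⟦ 2 ⟧) ([x-2]+1≡x-1 x) [x-2]ₖ≢0 [x-1]ₖ≢0 yₖ≢0)
    (f-suc k (x - ⟦ 1 ⟧) y [x-1]ₖ₊₁≢0 yₖ₊₁≢0)
    (f-suc k (x - ⟦ 2 ⟧) y [x-2]ₖ₊₁≢0 yₖ₊₁≢0)
    (poch-suc≢0⇒z≢0 (x - ⟦ 2 ⟧) k [x-2]ₖ₊₁≢0)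
    (poch-suc≢0⇒z+k≢0 (x - ⟦ 1 ⟧) k [x-1]ₖ₊₁≢0)
    (poch-suc≢0⇒z+k≢0 (x - ⟦ 2 ⟧) k [x-2]ₖ₊₁≢0)
    (poch-suc≢0⇒z+k≢0 y k yₖ₊₁≢0)
  where
  [x-2]ₖ≢0 = poch-suc≢0⇒poch≢0 (x - ⟦ 2 ⟧) k [x-2]ₖ₊₁≢0
  [x-1]ₖ≢0 = poch-suc≢0⇒poch≢0 (x - ⟦ 1 ⟧) k [x-1]ₖ₊₁≢0
  yₖ≢0     = poch-suc≢0⇒poch≢0 y k yₖ₊₁≢0
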